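{- Let $(A_i,B_i,C_i)_{i\in I}$ be an STPP construction in an abelian group $H$. Then there is a border tricolored sum-free set in $H$ of cardinality at least \[ \sum_{i\in I}\frac{\lvert A_i\rvert\lvert B_i\rvert\lvert C_i\rvert}{\lvert A_i\rvert+\lvert B_i\rvert+\lvert C_i\rvert}. \]
   Context: $H$ is written additively; for $X,Y\subseteq H$ write $X-Y=\{x-y:x\in X,y\in Y\}$. Subsets $A,B,C\subseteq H$ satisfy the triple product property if for all $a\in A-A$, $b\in B-B$, $c\in C-C$: $a+b+c=0$ iff $a=b=c=0$. An STPP construction in $H$ is a finite collection $(A_i,B_i,C_i)_{i\in I}$ of triples of finite nonempty subsets of $H$ such that each triple satisfies the triple product property, and, with $S_i=A_i-B_i$, $T_j=B_j-C_j$, $U_k=C_k-A_k$, whenever $s+t+u=0$ with $s\in S_i,t\in T_j,u\in U_k$ we have $i=j=k$. A border tricolored sum-free set in $H$ is a set $M\subseteq S\times T\times U$ with $S,T,U\subseteq H$ that is a 3-dimensional perfect matching on $S\times T\times U$ (each coordinate projection of $M$ is a bijection onto $S$, $T$, $U$ respectively), together with functions $\alpha:S\to\mathbb{Z}$, $\beta:T\to\mathbb{Z}$, $\gamma:U\to\mathbb{Z}$, such that $s+t+u=0$ and $\alpha(s)+\beta(t)+\gamma(u)=0$ for all $(s,t,u)\in M$, while for all $(s,t,u)\in(S\times T\times U)\setminus M$ either $s+t+u\neq0$ or $\alpha(s)+\beta(t)+\gamma(u)>0$. Its cardinality is $\lvert M\rvert$. -}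

module Defs where

open import Level using (Level)
open import Data.Nat as ℕ using (ℕ; zero; suc)
open import Data.Integer as ℤ using (ℤ; +_)
open import Data.Rational as ℚ using (ℚ)
open import Data.Fin using (Fin; zero; suc)
open import Data.Product using (Σ; _×_; _,_)
open import Data.Sum using (_⊎_)
open import Data.List.NonEmpty as List⁺ using (List⁺; toList)
open import Data.List.Membership.Propositional using (_∈_)
open import Data.List.Relation.Unary.Unique.Setoid using (Unique)
open import Relation.Binary.PropositionalEquality using (_≡_)
open import Relation.Nullary using (¬_)
open import Algebra.Bundles using (AbelianGroup)

sumℚ : ∀ {n} → (Fin n → ℚ) → ℚ
sumℚ {zero}  f = ℚ.0ℚ
sumℚ {suc n} f = f zero ℚ.+ sumℚ (λ i → f (suc i))

module _ {c ℓ : Level} (H : AbelianGroup c ℓ) where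
  open AbelianGroup H renaming (Carrier to G)

  -- additive notation: _∙_ is the group addition, ε is 0, _⁻¹ is negation
  -- _-_ from the library: x - y = x ∙ (y ⁻¹)

  -- A finite nonempty subset of H: a nonempty list without repetitions (w.r.t. ≈).
  IsFinSet : List⁺ G → Set (c Level.⊔ ℓ)
  IsFinSet X = Unique setoid (toList X)

  TPP : List⁺ G → List⁺ G → List⁺ G → Set (c Level.⊔ ℓ)
  TPP A B C =
    ∀ {a a′ b b′ x x′} →
    a ∈ toList A → a′ ∈ toList A →
    b ∈ toList B → b′ ∈ toList B →
    x ∈ toList C → x′ ∈ toList C →
    (((a - a′) ∙ (b - b′)) ∙ (x - x′) ≈ ε →
        (a - a′ ≈ ε) × (b - b′ ≈ ε) × (x - x′ ≈ ε))
    × ((a - a′ ≈ ε) × (b - b′ ≈ ε) × (x - x′ ≈ ε) →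
        ((a - a′) ∙ (b - b′)) ∙ (x - x′) ≈ ε)

  -- STPP construction indexed by I = Fin n.
  -- s ∈ S_i = A_i - B_i, t ∈ T_j = B_j - C_j, u ∈ U_k = C_k - A_k.
  IsSTPP : (n : ℕ) → (A B C : Fin n → List⁺ G) → Set (c Level.⊔ ℓ)
  IsSTPP n A B C =
    (∀ i → IsFinSet (A i) × IsFinSet (B i) × IsFinSet (C i))
    × (∀ i → TPP (A i) (B i) (C i))
    × (∀ i j k {a b b′ x x′ a′} →
         a ∈ toList (A i) → b ∈ toList (B i) →
         b′ ∈ toList (B j) → x ∈ toList (C j) →
         x′ ∈ toList (C k) → a′ ∈ toList (A k) →
         ((a - b) ∙ (b′ - x)) ∙ (x′ - a′) ≈ ε → (i ≡ j) × (j ≡ k))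

  -- M = {(s m, t m, u m) : m : Fin N}, S = image s, T = image t, U = image u;
  -- injectivity of s, t, u makes each coordinate projection M → S, T, U a
  -- bijection (perfect matching).  Functions α : S → ℤ etc. are given via
  -- these bijections as α : Fin N → ℤ (α m = value at s m).
  -- A triple (s x, t y, u z) ∈ S × T × U lies in M iff x ≡ y and y ≡ z.
  record BorderTSF (N : ℕ) : Set (c Level.⊔ ℓ) where
    field
      s t u : Fin N → G
      s-inj : ∀ x y → s x ≈ s y → x ≡ y
      t-inj : ∀ x y → t x ≈ t y → x ≡ y
      u-inj : ∀ x y → u x ≈ u y → x ≡ y
      α β γ : Fin N → ℤ
      onM-sum : ∀ m → (s m ∙ t m) ∙ u m ≈ ε
      onM-wt  : ∀ m → (α m ℤ.+ β m) ℤ.+ γ m ≡ + 0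
      offM    : ∀ x y z → ¬ ((x ≡ y) × (y ≡ z)) →
                  (¬ ((s x ∙ t y) ∙ u z ≈ ε)) ⊎ ((α x ℤ.+ β y) ℤ.+ γ z ℤ.> + 0)

  weight : List⁺ G → List⁺ G → List⁺ G → ℚ
  weight A B C =
    (+ (List⁺.length A ℕ.* List⁺.length B ℕ.* List⁺.length C))
      ℚ./ (List⁺.length A ℕ.+ List⁺.length B ℕ.+ List⁺.length C)

-- Index each block p by positions, and call i + j + k the height of a triple (i, j, k)
-- of positions in A p, B p, C p.  By pigeonhole some height L p is attained by at least
-- |A||B||C| / (|A| + |B| + |C|) triples; the matching consists of the elements
-- (a_i - b_j, b_j - c_k, c_k - a_i) for the triples of height L p in all blocks.
-- Here s sees only (i, j), t only (j, k) and u only (k, i), and when s + t + u = 0 for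
-- entries taken from three triples x, y, z, the STPP conditions force the three to lie
-- in one block with x, y sharing j, y, z sharing k and z, x sharing i; so they determine
-- one triple (i, j, k).  The weights α = i² + 2ij - 2Li + L², β = j² + 2jk - 2Lj and
-- γ = k² + 2ki - 2Lk sum to (i + j + k - L)², which is positive unless (i, j, k) has
-- height L, and then x = y = z.

module Submission where

open import Defs
open import Level using (Level)
open import Algebra.Bundles using (AbelianGroup)
import Algebra.Properties.CommutativeSemigroup as CommutativeSemigroup
open import Data.Bool using (true; false; if_then_else_)
open import Data.Empty using (⊥-elim)
open import Data.Fin using (Fin; toℕ)
import Data.Fin.Properties as Fin
open import Data.Integer as ℤ using (ℤ; +_; -[1+_]; +[1+_])
import Data.Integer.Properties as ℤ
open import Data.Integer.Tactic.RingSolver using (solve-∀)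
open import Data.List as List
  using (List; []; _∷_; length; filter; map; concat; tabulate; allFin; lookup; cartesianProduct)
import Data.List.Properties as List
open import Data.List.Membership.Propositional using (_∈_)
open import Data.List.Membership.Propositional.Properties
  using (∈-lookup; ∈-map⁻; ∈-filter⁻; ∈-concat⁻′; ∈-tabulate⁻)
open import Data.List.NonEmpty as List⁺ using (List⁺; toList)
open import Data.List.Relation.Unary.All as All using (All; []; _∷_)
import Data.List.Relation.Unary.All.Properties as All
open import Data.List.Relation.Unary.AllPairs using ([]; _∷_)
import Data.List.Relation.Unary.AllPairs.Properties as AllPairs
open import Data.List.Relation.Unary.Unique.Setoid using (Unique)
import Data.List.Relation.Unary.Unique.Propositional as ≡
import Data.List.Relation.Unary.Unique.Propositional.Properties as Unique
open import Data.List.Relation.Binary.Disjoint.Propositional using (Disjoint)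
open import Data.Nat as ℕ using (ℕ; zero; suc; _≟_)
import Data.Nat.Properties as ℕ
open import Data.Nat.ListAction using (sum)
import Data.Nat.Coprimality as Coprime
open import Data.Product using (Σ; ∃; _×_; _,_; proj₁; proj₂)
open import Data.Rational as ℚ using (ℚ; _/_; _≤_)
import Data.Rational.Properties as ℚ
import Data.Rational.Unnormalised as ℚᵘ
import Data.Rational.Unnormalised.Properties as ℚᵘ
open import Data.Sum using (_⊎_; inj₁; inj₂)
open import Function using (_∘_)
open import Relation.Binary.Bundles using (Setoid)
open import Relation.Binary.PropositionalEquality
  using (_≡_; _≢_; refl; cong; cong₂; subst; subst₂; module ≡-Reasoning)
  renaming (sym to ≡-sym; trans to ≡-trans; setoid to ≡-setoid)
open import Relation.Nullary using (¬_; does)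
open import Relation.Nullary.Decidable using (yes; no; dec-true; dec-false)

αᴸ βᴸ γᴸ : ℤ → ℤ → ℤ → ℤ
αᴸ L i j = i ℤ.* i ℤ.+ + 2 ℤ.* i ℤ.* j ℤ.- + 2 ℤ.* L ℤ.* i ℤ.+ L ℤ.* L
βᴸ L j k = j ℤ.* j ℤ.+ + 2 ℤ.* j ℤ.* k ℤ.- + 2 ℤ.* L ℤ.* j
γᴸ L k i = k ℤ.* k ℤ.+ + 2 ℤ.* k ℤ.* i ℤ.- + 2 ℤ.* L ℤ.* k

α+β+γ≡square : ∀ L i j k →
  αᴸ L i j ℤ.+ βᴸ L j k ℤ.+ γᴸ L k i ≡ (i ℤ.+ j ℤ.+ k ℤ.- L) ℤ.* (i ℤ.+ j ℤ.+ k ℤ.- L)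
α+β+γ≡square = unfolded
  where
  -- solve-∀ does not unfold αᴸ, βᴸ, γᴸ.
  unfolded : ∀ L i j k →
    (i ℤ.* i ℤ.+ + 2 ℤ.* i ℤ.* j ℤ.- + 2 ℤ.* L ℤ.* i ℤ.+ L ℤ.* L)
      ℤ.+ (j ℤ.* j ℤ.+ + 2 ℤ.* j ℤ.* k ℤ.- + 2 ℤ.* L ℤ.* j)
      ℤ.+ (k ℤ.* k ℤ.+ + 2 ℤ.* k ℤ.* i ℤ.- + 2 ℤ.* L ℤ.* k)
    ≡ (i ℤ.+ j ℤ.+ k ℤ.- L) ℤ.* (i ℤ.+ j ℤ.+ k ℤ.- L)
  unfolded = solve-∀

square-pos : ∀ d → d ≢ + 0 → + 0 ℤ.< d ℤ.* d
square-pos (+ 0)    d≢0 = ⊥-elim (d≢0 refl)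
square-pos +[1+ n ] _   = ℤ.+<+ (ℕ.s≤s ℕ.z≤n)
square-pos -[1+ n ] _   = ℤ.+<+ (ℕ.s≤s ℕ.z≤n)

levelWeight : ℕ → ℕ → ℕ → ℕ → ℤ
levelWeight L i j k = αᴸ (+ L) (+ i) (+ j) ℤ.+ βᴸ (+ L) (+ j) (+ k) ℤ.+ γᴸ (+ L) (+ k) (+ i)

levelWeight≡square : ∀ L i j k →
  levelWeight L i j k ≡ (+ (i ℕ.+ j ℕ.+ k) ℤ.- + L) ℤ.* (+ (i ℕ.+ j ℕ.+ k) ℤ.- + L)
levelWeight≡square L i j k
  rewrite ℤ.pos-+ (i ℕ.+ j) k | ℤ.pos-+ i j = α+β+γ≡square (+ L) (+ i) (+ j) (+ k)

levelWeight-onLevel : ∀ L i j k → i ℕ.+ j ℕ.+ k ≡ L → levelWeight L i j k ≡ + 0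
levelWeight-onLevel L i j k refl
  rewrite levelWeight≡square L i j k | ℤ.+-inverseʳ (+ L) = refl

levelWeight-nonpos⇒onLevel : ∀ L i j k → ¬ (+ 0 ℤ.< levelWeight L i j k) → i ℕ.+ j ℕ.+ k ≡ L
levelWeight-nonpos⇒onLevel L i j k w≯0 with (+ (i ℕ.+ j ℕ.+ k) ℤ.- + L) ℤ.≟ + 0
... | yes d≡0 = ℤ.+-injective (ℤ.i-j≡0⇒i≡j _ _ d≡0)
... | no  d≢0 = ⊥-elim (w≯0 (subst (+ 0 ℤ.<_) (≡-sym (levelWeight≡square L i j k)) (square-pos _ d≢0)))

sumBelow : ℕ → (ℕ → ℕ) → ℕ
sumBelow zero    f = 0
sumBelow (suc R) f = sumBelow R f ℕ.+ f R

sumBelow-cong : ∀ R {f g} → (∀ L → f L ≡ g L) → sumBelow R f ≡ sumBelow R g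
sumBelow-cong zero    f≗g = refl
sumBelow-cong (suc R) f≗g = cong₂ ℕ._+_ (sumBelow-cong R f≗g) (f≗g R)

sumBelow-+ : ∀ R f g → sumBelow R (λ L → f L ℕ.+ g L) ≡ sumBelow R f ℕ.+ sumBelow R g
sumBelow-+ zero    f g = refl
sumBelow-+ (suc R) f g rewrite sumBelow-+ R f g =
  CommutativeSemigroup.interchange ℕ.+-commutativeSemigroup (sumBelow R f) (sumBelow R g) (f R) (g R)

sumBelow-zero : ∀ R → sumBelow R (λ _ → 0) ≡ 0
sumBelow-zero zero    = refl
sumBelow-zero (suc R) = cong (ℕ._+ 0) (sumBelow-zero R)

pigeonhole : ∀ R f → ∃ λ L → sumBelow R f ℕ.≤ R ℕ.* f L
pigeonhole zero    f = 0 , ℕ.z≤n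
pigeonhole (suc R) f with pigeonhole R f
... | L , ih with f R ℕ.≤? f L
...   | yes fR≤fL = L , (begin
          sumBelow R f ℕ.+ f R ≤⟨ ℕ.+-mono-≤ ih fR≤fL ⟩
          R ℕ.* f L ℕ.+ f L    ≡⟨ ℕ.+-comm (R ℕ.* f L) (f L) ⟩
          suc R ℕ.* f L        ∎)
  where open ℕ.≤-Reasoning
...   | no  fR≰fL = R , (begin
          sumBelow R f ℕ.+ f R ≤⟨ ℕ.+-monoˡ-≤ (f R) ih ⟩
          R ℕ.* f L ℕ.+ f R    ≤⟨ ℕ.+-monoˡ-≤ (f R) (ℕ.*-monoʳ-≤ R (ℕ.≰⇒≥ fR≰fL)) ⟩
          R ℕ.* f R ℕ.+ f R    ≡⟨ ℕ.+-comm (R ℕ.* f R) (f R) ⟩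
          suc R ℕ.* f R        ∎)
  where open ℕ.≤-Reasoning

indicator : ℕ → ℕ → ℕ
indicator m L = if does (m ≟ L) then 1 else 0

indicator-≡ : ∀ m → indicator m m ≡ 1
indicator-≡ m = cong (if_then 1 else 0) (dec-true (m ≟ m) refl)

indicator-≢ : ∀ {m L} → m ≢ L → indicator m L ≡ 0
indicator-≢ {m} {L} m≢L = cong (if_then 1 else 0) (dec-false (m ≟ L) m≢L)

sumBelow-indicator-≤ : ∀ {m} R → R ℕ.≤ m → sumBelow R (indicator m) ≡ 0
sumBelow-indicator-≤ zero    _   = refl
sumBelow-indicator-≤ (suc R) R<m =
  cong₂ ℕ._+_ (sumBelow-indicator-≤ R (ℕ.<⇒≤ R<m)) (indicator-≢ (ℕ.>⇒≢ R<m))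

sumBelow-indicator : ∀ {m} R → m ℕ.< R → sumBelow R (indicator m) ≡ 1
sumBelow-indicator {m} (suc R) m<1+R with m ≟ R
... | yes refl = cong₂ ℕ._+_ (sumBelow-indicator-≤ m ℕ.≤-refl) (indicator-≡ m)
... | no  m≢R  = cong₂ ℕ._+_ (sumBelow-indicator R (ℕ.≤∧≢⇒< (ℕ.s≤s⁻¹ m<1+R) m≢R)) (indicator-≢ m≢R)

module _ {a} {X : Set a} (level : X → ℕ) where

  count : ℕ → List X → ℕ
  count L xs = length (filter (λ x → level x ≟ L) xs)

  count-∷ : ∀ L x xs → count L (x ∷ xs) ≡ indicator (level x) L ℕ.+ count L xs
  count-∷ L x xs with does (level x ≟ L)
  ... | true  = refl
  ... | false = refl

  sumBelow-count : ∀ R {xs} → All (λ x → level x ℕ.< R) xs →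
    sumBelow R (λ L → count L xs) ≡ length xs
  sumBelow-count R []                    = sumBelow-zero R
  sumBelow-count R {x ∷ xs} (x<R ∷ xs<R) = begin
    sumBelow R (λ L → count L (x ∷ xs))
      ≡⟨ sumBelow-cong R (λ L → count-∷ L x xs) ⟩
    sumBelow R (λ L → indicator (level x) L ℕ.+ count L xs)
      ≡⟨ sumBelow-+ R (indicator (level x)) (λ L → count L xs) ⟩
    sumBelow R (indicator (level x)) ℕ.+ sumBelow R (λ L → count L xs)
      ≡⟨ cong₂ ℕ._+_ (sumBelow-indicator R x<R) (sumBelow-count R xs<R) ⟩
    suc (length xs)
      ∎
    where open ≡-Reasoning

  popularLevel : ∀ R {xs} → All (λ x → level x ℕ.< R) xs → ∃ λ L → length xs ℕ.≤ R ℕ.* count L xs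
  popularLevel R {xs} xs<R with pigeonhole R (λ L → count L xs)
  ... | L , sum≤ = L , subst (ℕ._≤ R ℕ.* count L xs) (sumBelow-count R xs<R) sum≤

length-allFin : ∀ n → length (allFin n) ≡ n
length-allFin n = List.length-tabulate {n = n} (λ i → i)

module _ {a} {X : Set a} where

  length-concat : (xss : List (List X)) → length (concat xss) ≡ sum (map length xss)
  length-concat []         = refl
  length-concat (xs ∷ xss) = ≡-trans (List.length-++ xs) (cong (length xs ℕ.+_) (length-concat xss))

  length-cartesianProduct : ∀ {b} {Y : Set b} (xs : List X) (ys : List Y) →
    length (cartesianProduct xs ys) ≡ length xs ℕ.* length ys
  length-cartesianProduct []       ys = refl
  length-cartesianProduct (x ∷ xs) ys = ≡-trans (List.length-++ (map (x ,_) ys))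
    (cong₂ ℕ._+_ (List.length-map (x ,_) ys) (length-cartesianProduct xs ys))

module _ {a ℓ} (S : Setoid a ℓ) where
  open Setoid S using (_≈_; sym)

  lookup-injective : ∀ {xs} → Unique S xs → ∀ {i j} → lookup xs i ≈ lookup xs j → i ≡ j
  lookup-injective (_    ∷ _) {Fin.zero}  {Fin.zero}  _ = refl
  lookup-injective (x≉xs ∷ _) {Fin.zero}  {Fin.suc j} x≈ = ⊥-elim (All.lookup x≉xs (∈-lookup j) x≈)
  lookup-injective (x≉xs ∷ _) {Fin.suc i} {Fin.zero}  ≈x = ⊥-elim (All.lookup x≉xs (∈-lookup i) (sym ≈x))
  lookup-injective (_ ∷ unique) {Fin.suc i} {Fin.suc j} eq = cong Fin.suc (lookup-injective unique eq)

/1-+ : ∀ m n → (+ m) / 1 ℚ.+ (+ n) / 1 ≡ (+ (m ℕ.+ n)) / 1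
/1-+ m n
  rewrite ℚ.normalize-coprime (Coprime.sym (Coprime.1-coprimeTo m))
        | ℚ.normalize-coprime (Coprime.sym (Coprime.1-coprimeTo n))
        = cong (_/ 1) (cong₂ ℤ._+_ (ℤ.*-identityʳ (+ m)) (ℤ.*-identityʳ (+ n)))

/-≤-/1 : ∀ m d N → m ℕ.≤ N ℕ.* suc d → (+ m) / suc d ≤ (+ N) / 1
/-≤-/1 m d N m≤Nd = ℚ.toℚᵘ-cancel-≤
  (ℚᵘ.≤-respˡ-≃ (ℚᵘ.≃-sym (ℚ.toℚᵘ-fromℚᵘ (ℚᵘ.mkℚᵘ (+ m) d)))
  (ℚᵘ.≤-respʳ-≃ (ℚᵘ.≃-sym (ℚ.toℚᵘ-fromℚᵘ (ℚᵘ.mkℚᵘ (+ N) 0)))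
    (ℚᵘ.*≤* (subst₂ ℤ._≤_ (≡-sym (ℤ.*-identityʳ (+ m))) (ℤ.pos-* N (suc d)) (ℤ.+≤+ m≤Nd)))))

sumℚ-≤-sum : ∀ {n} (w : Fin n → ℚ) (N : Fin n → ℕ) → (∀ p → w p ≤ (+ N p) / 1) →
  sumℚ w ≤ (+ sum (tabulate N)) / 1
sumℚ-≤-sum {zero}  w N w≤N = ℚ.≤-refl
sumℚ-≤-sum {suc n} w N w≤N =
  subst (sumℚ w ≤_) (/1-+ (N Fin.zero) (sum (tabulate (N ∘ Fin.suc))))
    (ℚ.+-mono-≤ (w≤N Fin.zero) (sumℚ-≤-sum (w ∘ Fin.suc) (N ∘ Fin.suc) (w≤N ∘ Fin.suc)))

module Differences {c ℓ} (H : AbelianGroup c ℓ) where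
  open AbelianGroup H renaming (refl to ≈-refl)
  open import Algebra.Solver.CommutativeMonoid commutativeMonoid using (solve; _⊜_; _⊕_)
  open import Relation.Binary.Reasoning.Setoid setoid

  regroup : ∀ x y z w v r → ((x - y) ∙ (z - w)) ∙ (v - r) ≈ ((x - r) ∙ (z - y)) ∙ (v - w)
  regroup x y z w v r =
    solve 6 (λ x y z w v r → ((x ⊕ y) ⊕ (z ⊕ w)) ⊕ (v ⊕ r) ⊜ ((x ⊕ r) ⊕ (z ⊕ y)) ⊕ (v ⊕ w))
      ≈-refl x (y ⁻¹) z (w ⁻¹) v (r ⁻¹)

  telescope : ∀ x y z → ((x - y) ∙ (y - z)) ∙ (z - x) ≈ ε
  telescope x y z = begin
    ((x - y) ∙ (y - z)) ∙ (z - x) ≈⟨ regroup x y y z z x ⟩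
    ((x - x) ∙ (y - y)) ∙ (z - z) ≈⟨ ∙-cong (∙-cong (inverseʳ x) (inverseʳ y)) (inverseʳ z) ⟩
    (ε ∙ ε) ∙ ε                   ≈⟨ ∙-cong (identityˡ ε) ≈-refl ⟩
    ε ∙ ε                         ≈⟨ identityˡ ε ⟩
    ε                             ∎

module Construction {c ℓ} (H : AbelianGroup c ℓ) {n : ℕ} (A B C : Fin n → List⁺ (AbelianGroup.Carrier H))
                    (stpp : IsSTPP H n A B C) where
  open AbelianGroup H renaming (Carrier to G; refl to ≈-refl; sym to ≈-sym; trans to ≈-trans)
  open Differences H
  open import Algebra.Properties.Group group using (x∙y⁻¹≈ε⇒x≈y)

  stpp-rigid : ∀ {p q r a b b′ c′ c″ a″} →
    a ∈ toList (A p) → b ∈ toList (B p) → b′ ∈ toList (B q) →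
    c′ ∈ toList (C q) → c″ ∈ toList (C r) → a″ ∈ toList (A r) →
    ((a - b) ∙ (b′ - c′)) ∙ (c″ - a″) ≈ ε →
    p ≡ q × q ≡ r × a ≈ a″ × b′ ≈ b × c″ ≈ c′
  stpp-rigid a∈ b∈ b′∈ c′∈ c″∈ a″∈ sum≈ε with proj₂ (proj₂ stpp) _ _ _ a∈ b∈ b′∈ c′∈ c″∈ a″∈ sum≈ε
  ... | refl , refl
    with proj₁ (proj₁ (proj₂ stpp) _ a∈ a″∈ b′∈ b∈ c″∈ c′∈) (≈-trans (≈-sym (regroup _ _ _ _ _ _)) sum≈ε)
  ... | a-a″≈ε , b′-b≈ε , c″-c′≈ε =
    refl , refl , x∙y⁻¹≈ε⇒x≈y _ _ a-a″≈ε , x∙y⁻¹≈ε⇒x≈y _ _ b′-b≈ε , x∙y⁻¹≈ε⇒x≈y _ _ c″-c′≈ε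

  |A| |B| |C| : Fin n → ℕ
  |A| p = List⁺.length (A p)
  |B| p = List⁺.length (B p)
  |C| p = List⁺.length (C p)

  Triple : Fin n → Set
  Triple p = Fin (|A| p) × Fin (|B| p) × Fin (|C| p)

  Cell : Set
  Cell = Σ (Fin n) Triple

  elemA : ∀ p → Fin (|A| p) → G
  elemA p = lookup (toList (A p))
  elemB : ∀ p → Fin (|B| p) → G
  elemB p = lookup (toList (B p))
  elemC : ∀ p → Fin (|C| p) → G
  elemC p = lookup (toList (C p))

  elemA-injective : ∀ p i i′ → elemA p i ≈ elemA p i′ → i ≡ i′
  elemA-injective p i i′ = lookup-injective setoid (proj₁ (proj₁ stpp p)) {i} {i′}
  elemB-injective : ∀ p j j′ → elemB p j ≈ elemB p j′ → j ≡ j′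
  elemB-injective p j j′ = lookup-injective setoid (proj₁ (proj₂ (proj₁ stpp p))) {j} {j′}
  elemC-injective : ∀ p k k′ → elemC p k ≈ elemC p k′ → k ≡ k′
  elemC-injective p k k′ = lookup-injective setoid (proj₂ (proj₂ (proj₁ stpp p))) {k} {k′}

  s t u : Cell → G
  s (p , i , j , k) = elemA p i - elemB p j
  t (p , i , j , k) = elemB p j - elemC p k
  u (p , i , j , k) = elemC p k - elemA p i

  data Aligned : Cell → Cell → Cell → Set where
    aligned : ∀ {p} i j k {i′ j′ k′} → Aligned (p , i , j , k′) (p , i′ , j , k) (p , i , j′ , k)

  meet : ∀ {x y z} → Aligned x y z → Cell
  meet (aligned {p} i j k) = p , i , j , k

  zero-sum⇒aligned : ∀ x y z → (s x ∙ t y) ∙ u z ≈ ε → Aligned x y z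
  zero-sum⇒aligned (p , i , j , _) (_ , _ , j′ , k) (_ , i″ , _ , k″) sum≈ε
    with stpp-rigid (∈-lookup i) (∈-lookup j) (∈-lookup j′) (∈-lookup k) (∈-lookup k″) (∈-lookup i″) sum≈ε
  ... | refl , refl , a≈a″ , b′≈b , c″≈c′
    with elemA-injective p i i″ a≈a″ | elemB-injective p j′ j b′≈b | elemC-injective p k″ k c″≈c′
  ... | refl | refl | refl = aligned i j k

  s-aligned : ∀ {x y} → s x ≈ s y → Aligned x y y
  s-aligned {x} {y@(p , i , j , k)} s≈ = zero-sum⇒aligned x y y
    (≈-trans (∙-cong (∙-cong s≈ ≈-refl) ≈-refl) (telescope (elemA p i) (elemB p j) (elemC p k)))

  t-aligned : ∀ {x y} → t x ≈ t y → Aligned y x y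
  t-aligned {x} {y@(p , i , j , k)} t≈ = zero-sum⇒aligned y x y
    (≈-trans (∙-cong (∙-cong ≈-refl t≈) ≈-refl) (telescope (elemA p i) (elemB p j) (elemC p k)))

  u-aligned : ∀ {x y} → u x ≈ u y → Aligned y y x
  u-aligned {x} {y@(p , i , j , k)} u≈ = zero-sum⇒aligned y y x
    (≈-trans (∙-cong ≈-refl u≈) (telescope (elemA p i) (elemB p j) (elemC p k)))

  height : ∀ p → Triple p → ℕ
  height _ (i , j , k) = toℕ i ℕ.+ toℕ j ℕ.+ toℕ k

  height-cancel₁ : ∀ {p} i′ i j k → height p (i′ , j , k) ≡ height p (i , j , k) → i′ ≡ i
  height-cancel₁ _ _ j k eq =
    Fin.toℕ-injective (ℕ.+-cancelʳ-≡ (toℕ j) _ _ (ℕ.+-cancelʳ-≡ (toℕ k) _ _ eq))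

  height-cancel₂ : ∀ {p} i j′ j k → height p (i , j′ , k) ≡ height p (i , j , k) → j′ ≡ j
  height-cancel₂ i _ _ k eq =
    Fin.toℕ-injective (ℕ.+-cancelˡ-≡ (toℕ i) _ _ (ℕ.+-cancelʳ-≡ (toℕ k) _ _ eq))

  height-cancel₃ : ∀ {p} i j k′ k → height p (i , j , k′) ≡ height p (i , j , k) → k′ ≡ k
  height-cancel₃ i j _ _ eq = Fin.toℕ-injective (ℕ.+-cancelˡ-≡ (toℕ i ℕ.+ toℕ j) _ _ eq)

  tag : ∀ p → Triple p → Cell
  tag p e = p , e

  triples : ∀ p → List (Triple p)
  triples p = cartesianProduct (allFin (|A| p)) (cartesianProduct (allFin (|B| p)) (allFin (|C| p)))

  module Levels (L : Fin n → ℕ) where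

    OnLevel : Cell → Set
    OnLevel (p , e) = height p e ≡ L p

    aligned⇒≡ : ∀ {x y z} (al : Aligned x y z) →
      OnLevel (meet al) → OnLevel x → OnLevel y → OnLevel z → x ≡ y × y ≡ z
    aligned⇒≡ (aligned i j k {i′} {j′} {k′}) onL onL-x onL-y onL-z
      with height-cancel₃ i j k′ k (≡-trans onL-x (≡-sym onL))
         | height-cancel₁ i′ i j k (≡-trans onL-y (≡-sym onL))
         | height-cancel₂ i j′ j k (≡-trans onL-z (≡-sym onL))
    ... | refl | refl | refl = refl , refl

    levelSet : ∀ p → List (Triple p)
    levelSet p = filter (λ e → height p e ≟ L p) (triples p)

    blockCells : Fin n → List Cell
    blockCells p = map (tag p) (levelSet p)

    cells : List Cell
    cells = concat (tabulate blockCells)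

    ∈cells⇒onLevel : ∀ {x} → x ∈ cells → OnLevel x
    ∈cells⇒onLevel x∈ with ∈-concat⁻′ _ x∈
    ... | _ , x∈xs , xs∈ with ∈-tabulate⁻ {f = blockCells} xs∈
    ... | p , refl with ∈-map⁻ (tag p) x∈xs
    ... | e , e∈ , refl = proj₂ (∈-filter⁻ (λ e → height p e ≟ L p) {xs = triples p} e∈)

    cells-unique : ≡.Unique cells
    cells-unique = Unique.concat⁺
      (All.tabulate⁺ (λ p → Unique.map⁺ {f = tag p} (λ { refl → refl })
                              (Unique.filter⁺ (λ e → height p e ≟ L p) (triples-unique p))))
      (AllPairs.tabulate⁺ tags-disjoint)
      where
      triples-unique : ∀ p → ≡.Unique (triples p)
      triples-unique p = Unique.cartesianProduct⁺ (Unique.allFin⁺ _)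
                           (Unique.cartesianProduct⁺ (Unique.allFin⁺ _) (Unique.allFin⁺ _))
      tags-disjoint : ∀ {p q} → p ≢ q → Disjoint (blockCells p) (blockCells q)
      tags-disjoint {p} {q} p≢q (x∈p , x∈q) with ∈-map⁻ (tag p) x∈p | ∈-map⁻ (tag q) x∈q
      ... | _ , _ , refl | _ , _ , refl = p≢q refl

    length-cells : length cells ≡ sum (tabulate (length ∘ levelSet))
    length-cells = begin
      length cells                                                 ≡⟨ length-concat (tabulate blockCells) ⟩
      sum (map length (tabulate blockCells))                       ≡⟨ cong sum (List.map-tabulate blockCells length) ⟩
      sum (tabulate (length ∘ blockCells))                         ≡⟨ cong sum (List.tabulate-cong (λ p → List.length-map (tag p) (levelSet p))) ⟩
      sum (tabulate (length ∘ levelSet))                           ∎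
      where open ≡-Reasoning

    α β γ : Cell → ℤ
    α (p , i , j , k) = αᴸ (+ L p) (+ toℕ i) (+ toℕ j)
    β (p , i , j , k) = βᴸ (+ L p) (+ toℕ j) (+ toℕ k)
    γ (p , i , j , k) = γᴸ (+ L p) (+ toℕ k) (+ toℕ i)

    s-injective : ∀ {x y} → x ∈ cells → y ∈ cells → s x ≈ s y → x ≡ y
    s-injective {x} {y} x∈ y∈ s≈ with s-aligned {x} {y} s≈
    ... | al@(aligned _ _ _) =
      proj₁ (aligned⇒≡ al (∈cells⇒onLevel y∈) (∈cells⇒onLevel x∈) (∈cells⇒onLevel y∈) (∈cells⇒onLevel y∈))

    t-injective : ∀ {x y} → x ∈ cells → y ∈ cells → t x ≈ t y → x ≡ y
    t-injective {x} {y} x∈ y∈ t≈ with t-aligned {x} {y} t≈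
    ... | al@(aligned _ _ _) =
      ≡-sym (proj₁ (aligned⇒≡ al (∈cells⇒onLevel y∈) (∈cells⇒onLevel y∈) (∈cells⇒onLevel x∈) (∈cells⇒onLevel y∈)))

    u-injective : ∀ {x y} → x ∈ cells → y ∈ cells → u x ≈ u y → x ≡ y
    u-injective {x} {y} x∈ y∈ u≈ with u-aligned {x} {y} u≈
    ... | al@(aligned _ _ _) =
      ≡-sym (proj₂ (aligned⇒≡ al (∈cells⇒onLevel y∈) (∈cells⇒onLevel y∈) (∈cells⇒onLevel y∈) (∈cells⇒onLevel x∈)))

    onLevel⇒weight-zero : ∀ x → OnLevel x → α x ℤ.+ β x ℤ.+ γ x ≡ + 0
    onLevel⇒weight-zero (p , i , j , k) = levelWeight-onLevel (L p) (toℕ i) (toℕ j) (toℕ k)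

    nonpositive-zero-sum⇒diagonal : ∀ {x y z} → x ∈ cells → y ∈ cells → z ∈ cells →
      ¬ (+ 0 ℤ.< α x ℤ.+ β y ℤ.+ γ z) → (s x ∙ t y) ∙ u z ≈ ε → x ≡ y × y ≡ z
    nonpositive-zero-sum⇒diagonal {x} {y} {z} x∈ y∈ z∈ w≯0 sum≈ε with zero-sum⇒aligned x y z sum≈ε
    ... | al@(aligned {p} i j k) =
      aligned⇒≡ al (levelWeight-nonpos⇒onLevel (L p) (toℕ i) (toℕ j) (toℕ k) w≯0)
        (∈cells⇒onLevel x∈) (∈cells⇒onLevel y∈) (∈cells⇒onLevel z∈)

    borderTSF : BorderTSF H (length cells)
    borderTSF = record
      { s = s ∘ cell ; t = t ∘ cell ; u = u ∘ cell
      ; s-inj = λ x y → cell-injective ∘ s-injective (cell∈ x) (cell∈ y)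
      ; t-inj = λ x y → cell-injective ∘ t-injective (cell∈ x) (cell∈ y)
      ; u-inj = λ x y → cell-injective ∘ u-injective (cell∈ x) (cell∈ y)
      ; α = α ∘ cell ; β = β ∘ cell ; γ = γ ∘ cell
      ; onM-sum = λ m → telescope _ _ _
      ; onM-wt  = λ m → onLevel⇒weight-zero (cell m) (∈cells⇒onLevel (cell∈ m))
      ; offM    = off-diagonal
      }
      where
      cell : Fin (length cells) → Cell
      cell = lookup cells
      cell∈ : ∀ m → cell m ∈ cells
      cell∈ = ∈-lookup
      cell-injective : ∀ {m m′} → cell m ≡ cell m′ → m ≡ m′
      cell-injective = lookup-injective (≡-setoid Cell) cells-unique
      off-diagonal : ∀ x y z → ¬ (x ≡ y × y ≡ z) →
        ¬ ((s (cell x) ∙ t (cell y)) ∙ u (cell z) ≈ ε) ⊎ (α (cell x) ℤ.+ β (cell y) ℤ.+ γ (cell z) ℤ.> + 0)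
      off-diagonal x y z x,y,z-distinct with + 0 ℤ.<? α (cell x) ℤ.+ β (cell y) ℤ.+ γ (cell z)
      ... | yes w>0 = inj₂ w>0
      ... | no  w≯0 = inj₁ λ sum≈ε →
        let x≡y , y≡z = nonpositive-zero-sum⇒diagonal (cell∈ x) (cell∈ y) (cell∈ z) w≯0 sum≈ε
        in x,y,z-distinct (cell-injective x≡y , cell-injective y≡z)

  size : Fin n → ℕ
  size p = |A| p ℕ.+ |B| p ℕ.+ |C| p

  height<size : ∀ p e → height p e ℕ.< size p
  height<size p (i , j , k) = ℕ.+-mono-< (ℕ.+-mono-< (Fin.toℕ<n i) (Fin.toℕ<n j)) (Fin.toℕ<n k)

  length-triples : ∀ p → length (triples p) ≡ |A| p ℕ.* |B| p ℕ.* |C| p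
  length-triples p = begin
    length (triples p)
      ≡⟨ length-cartesianProduct (allFin (|A| p)) (cartesianProduct (allFin (|B| p)) (allFin (|C| p))) ⟩
    length (allFin (|A| p)) ℕ.* length (cartesianProduct (allFin (|B| p)) (allFin (|C| p)))
      ≡⟨ cong (length (allFin (|A| p)) ℕ.*_) (length-cartesianProduct (allFin (|B| p)) (allFin (|C| p))) ⟩
    length (allFin (|A| p)) ℕ.* (length (allFin (|B| p)) ℕ.* length (allFin (|C| p)))
      ≡⟨ cong₂ ℕ._*_ (length-allFin (|A| p)) (cong₂ ℕ._*_ (length-allFin (|B| p)) (length-allFin (|C| p))) ⟩
    |A| p ℕ.* (|B| p ℕ.* |C| p)
      ≡⟨ ℕ.*-assoc (|A| p) (|B| p) (|C| p) ⟨
    |A| p ℕ.* |B| p ℕ.* |C| p                          ∎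
    where open ≡-Reasoning

  popular : ∀ p → ∃ λ L → length (triples p) ℕ.≤ size p ℕ.* count (height p) L (triples p)
  popular p = popularLevel (height p) (size p) (All.universal (height<size p) (triples p))

  popularLevels : Fin n → ℕ
  popularLevels = proj₁ ∘ popular

  open Levels popularLevels public

  weight≤length-levelSet : ∀ p → weight H (A p) (B p) (C p) ≤ (+ length (levelSet p)) / 1
  weight≤length-levelSet p = /-≤-/1 _ _ (length (levelSet p)) (begin
    |A| p ℕ.* |B| p ℕ.* |C| p      ≡⟨ length-triples p ⟨
    length (triples p)             ≤⟨ proj₂ (popular p) ⟩
    size p ℕ.* length (levelSet p) ≡⟨ ℕ.*-comm (size p) (length (levelSet p)) ⟩
    length (levelSet p) ℕ.* size p ∎)
    where open ℕ.≤-Reasoning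

  weightSum≤length-cells : sumℚ (λ p → weight H (A p) (B p) (C p)) ≤ (+ length cells) / 1
  weightSum≤length-cells = subst (λ N → sumℚ (λ p → weight H (A p) (B p) (C p)) ≤ (+ N) / 1) (≡-sym length-cells)
    (sumℚ-≤-sum _ (length ∘ levelSet) weight≤length-levelSet)

theorem3p3 : ∀ {c ℓ : Level} (H : AbelianGroup c ℓ) (n : ℕ)
    (A B C : Fin n → List⁺ (AbelianGroup.Carrier H)) →
    IsSTPP H n A B C →
    Σ ℕ (λ N → BorderTSF H N × (sumℚ (λ i → weight H (A i) (B i) (C i)) ≤ (+ N) / 1))
theorem3p3 H n A B C stpp = length cells , borderTSF , weightSum≤length-cells
  where open Construction H A B C stpp
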